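{- The self-exponential $\Omega^\Omega$ is not locally finite, although $\Omega$ is locally finite. In particular, there exist locally finite minions $\mathcal M,\mathcal N$ such that $\mathcal N^{\mathcal M}$ is not locally finite.
   Context: Write $n=\{0,\dots,n-1\}$. A minion $\mathcal M$ consists of sets $\mathcal M_l$ ($l\ge1$) and maps $f\mapsto f\alpha$ for each map $\alpha:l\to m$ with $f\,\mathrm{id}=f$, $(f\alpha)\beta=f(\beta\circ\alpha)$; homomorphisms are arity-wise maps commuting with these; locally finite means each $\mathcal M_l$ is finite. An $n$-cosieve is a set $K$ of maps $n\to k$ (arbitrary positive $k$) such that $\alpha\in K$ implies $\beta\circ\alpha\in K$ for every $\beta:k\to k'$. The minion $\Omega$ has $\Omega_n$ the set of $n$-cosieves, and $\alpha:n\to n'$ sends $K$ to $\{\beta:n'\to k\mid \beta\circ\alpha\in K\}$. The projection minion $\mathcal P$ has $\mathcal P_l=l$, $i\alpha=\alpha(i)$; $(\mathcal P^n)_k$ is identified with maps $n\to k$. The exponential $\mathcal N^{\mathcal M}$ has $(\mathcal N^{\mathcal M})_n$ the set of homomorphisms $H:\mathcal P^n\times\mathcal M\to\mathcal N$ (product taken arity-wise), and $\alpha:n\to n'$ sends $H$ to $(\beta,m)\mapsto H(\beta\circ\alpha,m)$. -}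

module Defs where

open import Data.Nat using (ℕ; suc)
open import Data.Fin using (Fin)
open import Data.Bool using (Bool; true)
open import Data.List using (List)
open import Data.List.Relation.Unary.Any using (Any)
open import Data.Product using (Σ; _×_; _,_; proj₁; proj₂)
open import Function using (id; _∘_)
open import Relation.Binary.Structures using (IsEquivalence)
open import Relation.Binary.PropositionalEquality as P using (_≡_; refl)

-- Convention: the arity index l : ℕ stands for the positive arity (suc l),
-- i.e. the finite set  Fin (suc l) = {0, …, l}.  So M l is  M_{l+1}.
[_] : ℕ → Set
[ l ] = Fin (suc l)

_≐_ : ∀ {l m} → ([ l ] → [ m ]) → ([ l ] → [ m ]) → Set
α ≐ β = ∀ i → α i ≡ β i

record Minion : Set₁ where
  field
    M        : ℕ → Set
    _≈_      : ∀ {l} → M l → M l → Set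
    ≈-equiv  : ∀ {l} → IsEquivalence (_≈_ {l})
    act      : ∀ {l m} → M l → ([ l ] → [ m ]) → M m
    act-cong : ∀ {l m} {f g : M l} {α β : [ l ] → [ m ]} →
               f ≈ g → α ≐ β → act f α ≈ act g β
    act-id   : ∀ {l} (f : M l) → act f id ≈ f
    act-comp : ∀ {l m k} (f : M l) (α : [ l ] → [ m ]) (β : [ m ] → [ k ]) →
               act (act f α) β ≈ act f (β ∘ α)

open Minion

record Hom (A B : Minion) : Set where
  field
    fun      : ∀ {l} → M A l → M B l
    fun-cong : ∀ {l} {x y : M A l} → _≈_ A x y → _≈_ B (fun x) (fun y)
    fun-act  : ∀ {l m} (x : M A l) (α : [ l ] → [ m ]) →
               _≈_ B (fun (act A x α)) (act B (fun x) α)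

open Hom

LocallyFinite : Minion → Set
LocallyFinite A = ∀ l → Σ (List (M A l)) λ xs → ∀ x → Any (_≈_ A x) xs

-- P^n, with (P^n)_k identified with the maps n → k; action by postcomposition.
Pow : ℕ → Minion
Pow n = record
  { M = λ k → [ n ] → [ k ]
  ; _≈_ = _≐_
  ; ≈-equiv = record { refl = λ _ → refl
                     ; sym = λ p i → P.sym (p i)
                     ; trans = λ p q i → P.trans (p i) (q i) }
  ; act = λ β α → α ∘ β
  ; act-cong = λ {_} {_} {f} {g} {α} {β} p q i → P.trans (P.cong α (p i)) (q (g i))
  ; act-id = λ f i → refl
  ; act-comp = λ f α β i → refl
  }

_×ᴹ_ : Minion → Minion → Minion
A ×ᴹ B = record
  { M = λ l → M A l × M B l
  ; _≈_ = λ x y → _≈_ A (proj₁ x) (proj₁ y) × _≈_ B (proj₂ x) (proj₂ y)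
  ; ≈-equiv = record
      { refl = IsEquivalence.refl (≈-equiv A) , IsEquivalence.refl (≈-equiv B)
      ; sym = λ p → IsEquivalence.sym (≈-equiv A) (proj₁ p)
                  , IsEquivalence.sym (≈-equiv B) (proj₂ p)
      ; trans = λ p q → IsEquivalence.trans (≈-equiv A) (proj₁ p) (proj₁ q)
                      , IsEquivalence.trans (≈-equiv B) (proj₂ p) (proj₂ q) }
  ; act = λ x α → act A (proj₁ x) α , act B (proj₂ x) α
  ; act-cong = λ p q → act-cong A (proj₁ p) q , act-cong B (proj₂ p) q
  ; act-id = λ x → act-id A (proj₁ x) , act-id B (proj₂ x)
  ; act-comp = λ x α β → act-comp A (proj₁ x) α β , act-comp B (proj₂ x) α β
  }

Exp : Minion → Minion → Minion
Exp N A = record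
  { M = λ n → Hom (Pow n ×ᴹ A) N
  ; _≈_ = λ {n} H H' → ∀ k (x : M (Pow n ×ᴹ A) k) → _≈_ N (fun H x) (fun H' x)
  ; ≈-equiv = record
      { refl = λ k x → IsEquivalence.refl (≈-equiv N)
      ; sym = λ p k x → IsEquivalence.sym (≈-equiv N) (p k x)
      ; trans = λ p q k x → IsEquivalence.trans (≈-equiv N) (p k x) (q k x) }
  ; act = expAct
  ; act-cong = λ {_} {_} {H} {H'} {α} {α'} p q k x →
      IsEquivalence.trans (≈-equiv N) (p k (proj₁ x ∘ α , proj₂ x))
        (fun-cong H' ((λ i → P.cong (proj₁ x) (q i)) , IsEquivalence.refl (≈-equiv A)))
  ; act-id = λ H k x → IsEquivalence.refl (≈-equiv N)
  ; act-comp = λ H α β k x → IsEquivalence.refl (≈-equiv N)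
  }
  where
  expAct : ∀ {n n'} → Hom (Pow n ×ᴹ A) N → ([ n ] → [ n' ]) → Hom (Pow n' ×ᴹ A) N
  expAct H α = record
    { fun = λ x → fun H (proj₁ x ∘ α , proj₂ x)
    ; fun-cong = λ p → fun-cong H ((λ i → proj₁ p (α i)) , proj₂ p)
    ; fun-act = λ x γ → fun-act H (proj₁ x ∘ α , proj₂ x) γ
    }

-- Since these are
-- sets of maps, membership depends only on the map (extensionally).
record Cosieve (n : ℕ) : Set where
  field
    mem      : ∀ k → ([ n ] → [ k ]) → Bool
    mem-ext  : ∀ {k} {α β : [ n ] → [ k ]} → α ≐ β → mem k α ≡ mem k β
    closed   : ∀ {k k'} (α : [ n ] → [ k ]) (β : [ k ] → [ k' ]) →
               mem k α ≡ true → mem k' (β ∘ α) ≡ true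

open Cosieve

Ω : Minion
Ω = record
  { M = Cosieve
  ; _≈_ = λ K K' → ∀ k α → mem K k α ≡ mem K' k α
  ; ≈-equiv = record
      { refl = λ k α → refl
      ; sym = λ p k α → P.sym (p k α)
      ; trans = λ p q k α → P.trans (p k α) (q k α) }
  ; act = ΩAct
  ; act-cong = λ {_} {_} {K} {K'} {α} {α'} p q k β →
      P.trans (p k (β ∘ α)) (mem-ext K' (λ i → P.cong β (q i)))
  ; act-id = λ K k α → refl
  ; act-comp = λ K α β k γ → refl
  }
  where
  ΩAct : ∀ {n n'} → Cosieve n → ([ n ] → [ n' ]) → Cosieve n'
  ΩAct K α = record
    { mem = λ k β → mem K k (β ∘ α)
    ; mem-ext = λ p → mem-ext K (λ i → p (α i))
    ; closed = λ β γ → closed K (β ∘ α) γ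
    }

{-# OPTIONS --safe #-}

-- An n-cosieve is generated by the endomaps of n it contains, because every β out of n
-- factors as β ∘ (preimage β ∘ β) through one of them; so Ω_n is the image of the finitely
-- many subsets of endomaps of n, and Ω is locally finite.
--
-- Each m gives an endomorphism □ m of Ω, sending K to the cosieve of those β : l → k with
-- γ ∘ β ∈ K for every γ : k → m, and hence an element of (Ω^Ω)_0. For i < j these elements
-- differ at the cosieve of non-injective maps out of j: by pigeonhole it contains every map
-- j → i, so id_j ∈ □ i, while id_j ∉ □ j. Infinitely many distinct elements of (Ω^Ω)_0
-- contradict local finiteness.

module Submission where

open import Defs
open import Level using (_⊔_)
open import Data.Bool using (Bool; true; false)
open import Data.Bool.Properties as Bool using (⇔→≡)
open import Data.Nat as ℕ using (ℕ; zero; suc)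
open import Data.Nat.Properties using (n<1+n)
open import Data.Fin as Fin using (Fin; toℕ)
open import Data.Fin.Properties using (any?; all?; pigeonhole; <⇒≢)
open import Data.Vec.Functional as Vector using (Vector)
open import Data.List using (List; []; _∷_; map; length; lookup; cartesianProductWith; allFin)
open import Data.List.Relation.Unary.Any using (here; there; index)
open import Data.List.Relation.Unary.Any.Properties using (lookup-index)
import Data.List.Relation.Unary.All as All
open import Data.List.Membership.Setoid.Properties using (∈-resp-≈; ∈-cartesianProductWith⁺)
open import Data.List.Membership.Propositional.Properties using (∈-allFin)
open import Data.List.Relation.Unary.Enumerates.Setoid using (IsEnumeration)
open import Data.List.Relation.Unary.Enumerates.Setoid.Properties using (map⁺)
open import Data.Product using (Σ; _×_; _,_; proj₂; ∃)
open import Function using (id; _∘_; _$_; _⇔_; mk⇔; Equivalence; Surjection)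
open import Function.Construct.Symmetry using (⇔-sym)
open import Function.Construct.Composition using (_⇔-∘_)
open import Function.Definitions using (Injective)
import Function.Consequences.Setoid as Consequences
open import Relation.Binary.Bundles using (Setoid)
open import Relation.Binary.Definitions using (_Respects_)
open import Relation.Binary.PropositionalEquality as ≡ using (_≡_; refl; _→-setoid_)
open import Relation.Nullary using (¬_; Dec; yes; no; does; contradiction)
open import Relation.Nullary.Decidable using (map′; dec-true; does-⇔; _×-dec_; _→-dec_; ¬?)
open import Relation.Unary using (Pred; Decidable)

Enumerable : ∀ {a ℓ} → Setoid a ℓ → Set (a ⊔ ℓ)
Enumerable S = Σ (List (Setoid.Carrier S)) (IsEnumeration S)

module _ {a ℓ} (S : Setoid a ℓ) where
  open Setoid S

  ∀-enumerated? : ∀ {p} {P : Pred Carrier p} → Enumerable S → P Respects _≈_ →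
                  Decidable P → Dec (∀ x → P x)
  ∀-enumerated? (xs , enum) resp P? =
    map′ (λ all x → let (Py , x≈y) = All.lookupAny all (enum x) in resp (sym x≈y) Py)
         (λ ∀P → All.universal ∀P xs)
         (All.all? P? xs)

  pairwise-distinct⇒¬enumerable : (x : ℕ → Carrier) → (∀ {i j} → i ℕ.< j → ¬ x i ≈ x j) →
                                  ¬ Enumerable S
  pairwise-distinct⇒¬enumerable x distinct (xs , enum)
    with i , j , i<j , same ← pigeonhole (n<1+n (length xs)) (index ∘ enum ∘ x ∘ toℕ)
    = distinct i<j (trans (listed i) (trans (reflexive (≡.cong (lookup xs) same)) (sym (listed j))))
    where
    listed : ∀ t → x (toℕ t) ≈ lookup xs (index (enum (x (toℕ t))))
    listed t = lookup-index (enum (x (toℕ t)))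

functions : ∀ {B : Set} a → List B → List (Vector B a)
functions zero    ys = Vector.[] ∷ []
functions (suc a) ys = cartesianProductWith Vector._∷_ ys (functions a ys)

functions-enumerates : ∀ {B : Set} {ys : List B} a → IsEnumeration (≡.setoid B) ys →
                       IsEnumeration (Fin a →-setoid B) (functions a ys)
functions-enumerates zero    _    f = here (λ ())
functions-enumerates {B} (suc a) enum f =
  ∈-resp-≈ (Fin (suc a) →-setoid B) head∷tail≗f
    (∈-cartesianProductWith⁺ (≡.setoid B) (Fin a →-setoid B) (Fin (suc a) →-setoid B)
       ∷-cong (enum (Vector.head f)) (functions-enumerates a enum (Vector.tail f)))
  where
  head∷tail≗f : ∀ i → (Vector.head f Vector.∷ Vector.tail f) i ≡ f i
  head∷tail≗f Fin.zero    = refl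
  head∷tail≗f (Fin.suc i) = refl
  ∷-cong : ∀ {y y' : B} {g g' : Vector B a} → y ≡ y' → (∀ i → g i ≡ g' i) →
           ∀ i → (y Vector.∷ g) i ≡ (y' Vector.∷ g') i
  ∷-cong y≡y' g≗g' Fin.zero    = y≡y'
  ∷-cong y≡y' g≗g' (Fin.suc i) = g≗g' i

functions-enumerable : ∀ a b → Enumerable (Fin a →-setoid Fin b)
functions-enumerable a b = functions a (allFin b) , functions-enumerates a ∈-allFin

does≡true⇔ : ∀ {p} {A : Set p} (a? : Dec A) → does a? ≡ true ⇔ A
does≡true⇔ (yes a) = mk⇔ (λ _ → a) (λ _ → refl)
does≡true⇔ (no ¬a) = mk⇔ (λ ()) (λ a → contradiction a ¬a)

open Minion
open Hom
open Cosieve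

arity-setoid : Minion → ℕ → Setoid _ _
arity-setoid A l = record { Carrier = M A l ; _≈_ = _≈_ A ; isEquivalence = ≈-equiv A }

cosieve : ∀ {n} {P : ∀ {k} → ([ n ] → [ k ]) → Set} →
          (∀ {k} (α : [ n ] → [ k ]) → Dec (P α)) →
          (∀ {k} {α β : [ n ] → [ k ]} → α ≐ β → P α → P β) →
          (∀ {k k'} (α : [ n ] → [ k ]) (β : [ k ] → [ k' ]) → P α → P (β ∘ α)) →
          Cosieve n
cosieve P? P-resp P-closed = record
  { mem     = λ k α → does (P? α)
  ; mem-ext = λ α≐β → does-⇔ (mk⇔ (P-resp α≐β) (P-resp (≡.sym ∘ α≐β))) (P? _) (P? _)
  ; closed  = λ α β α∈ → dec-true (P? (β ∘ α))
                           (P-closed α β (Equivalence.to (does≡true⇔ (P? α)) α∈))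
  }

_FactorsThrough_ : ∀ {n k m} → ([ n ] → [ k ]) → ([ n ] → [ m ]) → Set
β FactorsThrough γ = ∃ λ δ → β ≐ (δ ∘ γ)

preimage : ∀ {n k} → ([ n ] → [ k ]) → [ k ] → [ n ]
preimage α y with any? (λ i → α i Fin.≟ y)
... | yes (i , _) = i
... | no _        = Fin.zero

preimage-spec : ∀ {n k} (α : [ n ] → [ k ]) i → α (preimage α (α i)) ≡ α i
preimage-spec α i with any? (λ j → α j Fin.≟ α i)
... | yes (_ , αj≡αi) = αj≡αi
... | no  ∄j          = contradiction (i , refl) ∄j

factorsThroughEndo : ∀ {n k} (β : [ n ] → [ k ]) → β FactorsThrough (preimage β ∘ β)
factorsThroughEndo β = β , ≡.sym ∘ preimage-spec β

-- β factors through γ iff ker γ ⊆ ker β, and the latter is a finite check.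
factorsThrough? : ∀ {n k m} (β : [ n ] → [ k ]) (γ : [ n ] → [ m ]) → Dec (β FactorsThrough γ)
factorsThrough? β γ =
  map′ factor unfactor (all? λ i → all? λ j → (γ i Fin.≟ γ j) →-dec (β i Fin.≟ β j))
  where
  factor : (∀ i j → γ i ≡ γ j → β i ≡ β j) → β FactorsThrough γ
  factor ker⊆ = β ∘ preimage γ , λ i → ker⊆ i _ (≡.sym (preimage-spec γ i))
  unfactor : β FactorsThrough γ → ∀ i j → γ i ≡ γ j → β i ≡ β j
  unfactor (δ , β≐δγ) i j γi≡γj = ≡.trans (β≐δγ i) (≡.trans (≡.cong δ γi≡γj) (≡.sym (β≐δγ j)))

mem⇔factorsThroughEndoMember : ∀ {n k} (K : Cosieve n) (β : [ n ] → [ k ]) →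
                               mem K k β ≡ true ⇔ ∃ λ γ → mem K n γ ≡ true × β FactorsThrough γ
mem⇔factorsThroughEndoMember K β = mk⇔
  (λ β∈K → preimage β ∘ β , closed K β (preimage β) β∈K , factorsThroughEndo β)
  (λ (γ , γ∈K , δ , β≐δγ) → ≡.trans (mem-ext K β≐δγ) (closed K γ δ γ∈K))

_FactorsThroughSome_⟨_⟩ : ∀ {n k m N} →
                          ([ n ] → [ k ]) → (Fin N → [ n ] → [ m ]) → (Fin N → Bool) → Set
β FactorsThroughSome γ ⟨ selected ⟩ = ∃ λ t → selected t ≡ true × β FactorsThrough γ t

factorsThroughSome? : ∀ {n k m N} (β : [ n ] → [ k ]) (γ : Fin N → [ n ] → [ m ])
                      (selected : Fin N → Bool) → Dec (β FactorsThroughSome γ ⟨ selected ⟩)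
factorsThroughSome? β γ selected = any? λ t → (selected t Bool.≟ true) ×-dec factorsThrough? β (γ t)

generated : ∀ {n m N} → (Fin N → [ n ] → [ m ]) → (Fin N → Bool) → Cosieve n
generated γ selected = cosieve (λ β → factorsThroughSome? β γ selected) resp postcompose
  where
  resp : ∀ {k} {α β : _ → [ k ]} → α ≐ β →
         α FactorsThroughSome γ ⟨ selected ⟩ → β FactorsThroughSome γ ⟨ selected ⟩
  resp α≐β (t , sel , δ , α≐δγ) = t , sel , δ , λ i → ≡.trans (≡.sym (α≐β i)) (α≐δγ i)
  postcompose : ∀ {k k'} (α : _ → [ k ]) (β : [ k ] → [ k' ]) →
                α FactorsThroughSome γ ⟨ selected ⟩ → (β ∘ α) FactorsThroughSome γ ⟨ selected ⟩
  postcompose α β (t , sel , δ , α≐δγ) = t , sel , β ∘ δ , ≡.cong β ∘ α≐δγ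

mem-generated : ∀ {n m N} (γ : Fin N → [ n ] → [ m ]) (selected : Fin N → Bool)
                {k} (β : [ n ] → [ k ]) →
                mem (generated γ selected) k β ≡ true ⇔ β FactorsThroughSome γ ⟨ selected ⟩
mem-generated γ selected β = does≡true⇔ (factorsThroughSome? β γ selected)

generated-cong : ∀ {n m N} (γ : Fin N → [ n ] → [ m ]) {c c' : Fin N → Bool} →
                 (∀ t → c t ≡ c' t) → _≈_ Ω (generated γ c) (generated γ c')
generated-cong γ {c} {c'} c≗c' k β = ⇔→≡ $
  ⇔-sym (mem-generated γ c' β) ⇔-∘ (reselect ⇔-∘ mem-generated γ c β)
  where
  reselect : ∀ {k} {β : _ → [ k ]} →
             β FactorsThroughSome γ ⟨ c ⟩ ⇔ β FactorsThroughSome γ ⟨ c' ⟩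
  reselect = mk⇔ (λ (t , sel , f) → t , ≡.trans (≡.sym (c≗c' t)) sel , f)
                 (λ (t , sel , f) → t , ≡.trans (c≗c' t) sel , f)

generated-by-endo-members : ∀ {n N} (γ : Fin N → [ n ] → [ n ]) → (∀ ε → ∃ λ t → ε ≐ γ t) →
                            (K : Cosieve n) → _≈_ Ω (generated γ (λ t → mem K n (γ t))) K
generated-by-endo-members {n} γ covers K k β = ⇔→≡ $
  ⇔-sym (mem⇔factorsThroughEndoMember K β) ⇔-∘ (reindex ⇔-∘ mem-generated γ _ β)
  where
  reindex : ∀ {k} {β : _ → [ k ]} →
            β FactorsThroughSome γ ⟨ (λ t → mem K n (γ t)) ⟩ ⇔
            (∃ λ ε → mem K n ε ≡ true × β FactorsThrough ε)
  reindex {β = β} = mk⇔ (λ (t , γt∈K , f) → γ t , γt∈K , f) from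
    where
    from : (∃ λ ε → mem K n ε ≡ true × β FactorsThrough ε) →
           β FactorsThroughSome γ ⟨ (λ t → mem K n (γ t)) ⟩
    from (ε , ε∈K , δ , β≐δε) with t , ε≐γt ← covers ε
      = t , ≡.trans (≡.sym (mem-ext K ε≐γt)) ε∈K , δ , λ i → ≡.trans (β≐δε i) (≡.cong δ (ε≐γt i))

Ω-locallyFinite : LocallyFinite Ω
Ω-locallyFinite n =
  map (generated endo) codes , map⁺ (Fin N →-setoid Bool) (arity-setoid Ω n) onto codes-enumerate
  where
  endos : List ([ n ] → [ n ])
  endos = functions (suc n) (allFin (suc n))
  N : ℕ
  N = length endos
  endo : Fin N → [ n ] → [ n ]
  endo = lookup endos
  codes : List (Fin N → Bool)
  codes = functions N (true ∷ false ∷ [])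
  codes-enumerate : IsEnumeration (Fin N →-setoid Bool) codes
  codes-enumerate = functions-enumerates N λ { true → here refl ; false → there (here refl) }
  endo-covers : ∀ ε → ∃ λ t → ε ≐ endo t
  endo-covers ε = let ε∈ = functions-enumerates (suc n) ∈-allFin ε in index ε∈ , lookup-index ε∈
  onto : Surjection (Fin N →-setoid Bool) (arity-setoid Ω n)
  onto = record
    { to = generated endo
    ; cong = generated-cong endo
    ; surjective =
        Consequences.strictlySurjective⇒surjective (Fin N →-setoid Bool) (arity-setoid Ω n)
          {f = generated endo} (generated-cong endo)
          (λ K → (λ t → mem K n (endo t)) , generated-by-endo-members endo endo-covers K)
    }

injective? : ∀ {l k} (α : [ l ] → [ k ]) → Dec (Injective _≡_ _≡_ α)
injective? α = map′ (λ inj {x} {y} → inj x y) (λ inj x y → inj)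
                    (all? λ x → all? λ y → (α x Fin.≟ α y) →-dec (x Fin.≟ y))

nonInjective : ∀ {l} → Cosieve l
nonInjective = cosieve (λ α → ¬? (injective? α)) resp precomposed
  where
  resp : ∀ {l k} {α β : [ l ] → [ k ]} → α ≐ β → ¬ Injective _≡_ _≡_ α → ¬ Injective _≡_ _≡_ β
  resp α≐β ¬inj-α inj-β = ¬inj-α λ {x} {y} αx≡αy →
    inj-β (≡.trans (≡.sym (α≐β x)) (≡.trans αx≡αy (α≐β y)))
  precomposed : ∀ {l k k'} (α : [ l ] → [ k ]) (β : [ k ] → [ k' ]) →
                ¬ Injective _≡_ _≡_ α → ¬ Injective _≡_ _≡_ (β ∘ α)
  precomposed α β ¬inj-α inj-βα = ¬inj-α (inj-βα ∘ ≡.cong β)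

mem-nonInjective : ∀ {l k} (α : [ l ] → [ k ]) →
                   mem nonInjective k α ≡ true ⇔ (¬ Injective _≡_ _≡_ α)
mem-nonInjective α = does≡true⇔ (¬? (injective? α))

_∈□[_]_ : ∀ {l k} → ([ l ] → [ k ]) → ℕ → Cosieve l → Set
_∈□[_]_ {k = k} β m K = ∀ (γ : [ k ] → [ m ]) → mem K m (γ ∘ β) ≡ true

∈□? : ∀ {l k} (β : [ l ] → [ k ]) (m : ℕ) (K : Cosieve l) → Dec (β ∈□[ m ] K)
∈□? {k = k} β m K = ∀-enumerated? ([ k ] →-setoid [ m ]) (functions-enumerable (suc k) (suc m))
                      (λ γ≗γ' → ≡.trans (≡.sym (mem-ext K (γ≗γ' ∘ β))))
                      (λ γ → mem K m (γ ∘ β) Bool.≟ true)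

□ : ∀ {l} → ℕ → Cosieve l → Cosieve l
□ m K = cosieve (λ β → ∈□? β m K) resp (λ β δ all-γ γ → all-γ (γ ∘ δ))
  where
  resp : ∀ {k} {β β' : _ → [ k ]} → β ≐ β' → β ∈□[ m ] K → β' ∈□[ m ] K
  resp β≐β' all-γ γ = ≡.trans (≡.sym (mem-ext K (≡.cong γ ∘ β≐β'))) (all-γ γ)

∈□-resp-≈ : ∀ {l k m} {K K' : Cosieve l} {β : [ l ] → [ k ]} →
            _≈_ Ω K K' → β ∈□[ m ] K → β ∈□[ m ] K'
∈□-resp-≈ {m = m} {β = β} K≈K' all-γ γ = ≡.trans (≡.sym (K≈K' m (γ ∘ β))) (all-γ γ)

mem-□ : ∀ {l k} (m : ℕ) (K : Cosieve l) (β : [ l ] → [ k ]) → mem (□ m K) k β ≡ true ⇔ β ∈□[ m ] K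
mem-□ m K β = does≡true⇔ (∈□? β m K)

□-hom : ℕ → Hom Ω Ω
□-hom m = record
  { fun      = □ m
  ; fun-cong = λ {_} {K} {K'} K≈K' k β →
      does-⇔ (mk⇔ (∈□-resp-≈ {K = K} {K'} K≈K') (∈□-resp-≈ {K = K'} {K} λ k α → ≡.sym (K≈K' k α)))
             (∈□? β m K) (∈□? β m K')
  ; fun-act  = λ K α k β → refl
  }

hom⇒exp : ∀ {A N} → Hom A N → ∀ {n} → M (Exp N A) n
hom⇒exp h = record
  { fun      = fun h ∘ proj₂
  ; fun-cong = fun-cong h ∘ proj₂
  ; fun-act  = λ x α → fun-act h (proj₂ x) α
  }

id∈□[<] : ∀ {i j} → i ℕ.< j → id ∈□[ i ] nonInjective {j}
id∈□[<] i<j γ with a , b , a<b , γa≡γb ← pigeonhole (ℕ.s<s i<j) γ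
  = Equivalence.from (mem-nonInjective γ) λ inj → <⇒≢ a<b (inj γa≡γb)

id∉□[≡] : ∀ {j} → ¬ id ∈□[ j ] nonInjective {j}
id∉□[≡] {j} all-γ = Equivalence.to (mem-nonInjective (id {A = [ j ]})) (all-γ id) id

□-separates : ∀ {i j} → i ℕ.< j → ¬ _≈_ (Exp Ω Ω) {0} (hom⇒exp (□-hom i)) (hom⇒exp (□-hom j))
□-separates {i} {j} i<j □i≈□j = id∉□[≡] $ Equivalence.to (mem-□ j nonInjective id) $ begin
  mem (□ j nonInjective) j id ≡⟨ □i≈□j j ((λ _ → Fin.zero) , nonInjective) j id ⟨
  mem (□ i nonInjective) j id ≡⟨ Equivalence.from (mem-□ i nonInjective id) (id∈□[<] i<j) ⟩
  true                        ∎
  where open ≡.≡-Reasoning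

ΩΩ-notLocallyFinite : ¬ LocallyFinite (Exp Ω Ω)
ΩΩ-notLocallyFinite finite =
  pairwise-distinct⇒¬enumerable (arity-setoid (Exp Ω Ω) 0) (λ m → hom⇒exp (□-hom m)) □-separates
    (finite 0)

corollary7p3p8 : (LocallyFinite Ω × ¬ LocallyFinite (Exp Ω Ω))
                 × Σ Minion (λ M → Σ Minion (λ N →
                     LocallyFinite M × LocallyFinite N × ¬ LocallyFinite (Exp N M)))
corollary7p3p8 = (Ω-locallyFinite , ΩΩ-notLocallyFinite)
               , Ω , Ω , Ω-locallyFinite , Ω-locallyFinite , ΩΩ-notLocallyFinite
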